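{- Let $U$ be a finite set of $n$ jobs, $V$ a finite set of $m$ machines, and $b(j,i)\ge 0$ integer tolerances for $j\in U$, $i\in V$. Every strongly-maximal PD-matching $M$ satisfies $|M|\ge \tfrac12 |M^*|$, where $M^*$ is a PD-matching of maximum cardinality.
   Context: A PD-matching is a set $M\subseteq U\times V$ such that every job $j\in U$ belongs to at most one pair of $M$, and for every $(j,i)\in M$ we have $d_i(M)\le b(j,i)$, where $d_i(M)=|\{j\in U:(j,i)\in M\}|$ is the degree of machine $i$ in $M$. A PD-matching $M$ is strongly-maximal if for every job $j\in U$ that belongs to no pair of $M$ and every machine $i\in V$, we have $b(j,i)\le d_i(M)$. -}

module Defs where

open import Data.Nat using (ℕ; zero; suc; _≤_; _+_)
open import Data.Fin using (Fin; zero; suc)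
open import Data.Fin.Properties using (_≟_)
open import Data.Maybe using (Maybe; just; nothing)
open import Relation.Nullary using (yes; no)
open import Relation.Binary.PropositionalEquality using (_≡_)

sumFin : ∀ {n} → (Fin n → ℕ) → ℕ
sumFin {zero} f = 0
sumFin {suc n} f = f zero + sumFin {n} (λ k → f (suc k))

-- Jobs U = Fin n, machines V = Fin m.
-- A set M ⊆ U × V in which every job belongs to at most one pair is encoded
-- as a partial map M : Fin n → Maybe (Fin m):  (j , i) ∈ M  iff  M j ≡ just i.
JobAssignment : ℕ → ℕ → Set
JobAssignment n m = Fin n → Maybe (Fin m)

pairInd : ∀ {n m} → JobAssignment n m → Fin n → Fin m → ℕ
pairInd M j i with M j
... | nothing = 0
... | just i' with i' ≟ i
...   | yes _ = 1
...   | no _  = 0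

matchedInd : ∀ {n m} → JobAssignment n m → Fin n → ℕ
matchedInd M j with M j
... | nothing = 0
... | just _  = 1

card : ∀ {n m} → JobAssignment n m → ℕ
card M = sumFin (matchedInd M)

degree : ∀ {n m} → JobAssignment n m → Fin m → ℕ
degree M i = sumFin (λ j → pairInd M j i)

IsPDMatching : ∀ {n m} → (Fin n → Fin m → ℕ) → JobAssignment n m → Set
IsPDMatching b M = ∀ j i → M j ≡ just i → degree M i ≤ b j i

IsStronglyMaximal : ∀ {n m} → (Fin n → Fin m → ℕ) → JobAssignment n m → Set
IsStronglyMaximal b M =
  IsPDMatching b M × (∀ j i → M j ≡ nothing → b j i ≤ degree M i)
  where open import Data.Product using (_×_)

IsMaximumPDMatching : ∀ {n m} → (Fin n → Fin m → ℕ) → JobAssignment n m → Set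
IsMaximumPDMatching b M* =
  IsPDMatching b M* × (∀ M → IsPDMatching b M → card M ≤ card M*)
  where open import Data.Product using (_×_)

{-# OPTIONS --safe #-}
-- Let M be strongly maximal and N any PD-matching. The jobs matched by both are at
-- most |M|. If N sends a job j that M leaves unmatched to machine i, then
-- d_i(N) ≤ b(j,i) ≤ d_i(M); so at every machine i, N has at most d_i(M) pairs whose
-- job M leaves unmatched, and summing over machines bounds these by Σ_i d_i(M) = |M|.
module Submission where

open import Defs
open import Data.Nat using (ℕ; _≤_; _*_; _+_; z≤n)
open import Data.Nat.Properties
  using (≤-refl; ≤-trans; ≤-reflexive; +-mono-≤; +-monoʳ-≤; +-identityʳ; _≤?_; +-0-commutativeMonoid; module ≤-Reasoning)
open import Data.Fin using (Fin; zero; suc; punchIn)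
open import Data.Fin.Properties using (_≟_; punchInᵢ≢i)
open import Data.Maybe using (just; nothing)
open import Data.Maybe.Properties using (just-injective)
open import Data.Product using (_×_; _,_; proj₂)
open import Data.Sum using (_⊎_; inj₁; inj₂)
open import Relation.Nullary using (yes; no; contradiction)
open import Relation.Binary.PropositionalEquality
open import Function using (_∘_)
open import Algebra.Properties.CommutativeMonoid.Sum +-0-commutativeMonoid
  using (sum; sum-cong-≗; sum-replicate-zero; sum-remove; ∑-distrib-+; ∑-comm)

sumFin≡sum : ∀ {n} (f : Fin n → ℕ) → sumFin f ≡ sum f
sumFin≡sum {ℕ.zero} f = refl
sumFin≡sum {ℕ.suc n} f = cong (f zero +_) (sumFin≡sum (λ k → f (suc k)))

sumFin-mono : ∀ {n} {f g : Fin n → ℕ} → (∀ k → f k ≤ g k) → sumFin f ≤ sumFin g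
sumFin-mono {ℕ.zero} f≤g = z≤n
sumFin-mono {ℕ.suc n} f≤g = +-mono-≤ (f≤g zero) (sumFin-mono (λ k → f≤g (suc k)))

sumFin-vanishing : ∀ {n} {f : Fin n → ℕ} → (∀ k → f k ≡ 0) → sumFin f ≡ 0
sumFin-vanishing {n} {f} f≡0 = begin
  sumFin f          ≡⟨ sumFin≡sum f ⟩
  sum f             ≡⟨ sum-cong-≗ f≡0 ⟩
  sum {n} (λ _ → 0) ≡⟨ sum-replicate-zero n ⟩
  0                 ∎
  where open ≡-Reasoning

sumFin-single : ∀ {n} {f : Fin n → ℕ} (x : Fin n) →
                (∀ k → k ≢ x → f k ≡ 0) → sumFin f ≡ f x
sumFin-single {ℕ.suc n} {f} x f≡0 = begin
  sumFin f                               ≡⟨ sumFin≡sum f ⟩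
  sum f                                  ≡⟨ sum-remove f ⟩
  f x + sum (λ k → f (punchIn x k))      ≡⟨ cong (f x +_) (sumFin≡sum {n} _) ⟨
  f x + sumFin (λ k → f (punchIn x k))
    ≡⟨ cong (f x +_) (sumFin-vanishing (λ k → f≡0 _ (punchInᵢ≢i x k))) ⟩
  f x + 0                                ≡⟨ +-identityʳ (f x) ⟩
  f x                                    ∎
  where open ≡-Reasoning

sumFin-+ : ∀ {n} (f g : Fin n → ℕ) → sumFin (λ k → f k + g k) ≡ sumFin f + sumFin g
sumFin-+ f g = begin
  sumFin (λ k → f k + g k)  ≡⟨ sumFin≡sum (λ k → f k + g k) ⟩
  sum (λ k → f k + g k)     ≡⟨ ∑-distrib-+ f g ⟩
  sum f + sum g             ≡⟨ cong₂ _+_ (sumFin≡sum f) (sumFin≡sum g) ⟨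
  sumFin f + sumFin g       ∎
  where open ≡-Reasoning

sumFin-comm : ∀ {n m} (f : Fin n → Fin m → ℕ) →
              sumFin (λ j → sumFin (f j)) ≡ sumFin (λ i → sumFin (λ j → f j i))
sumFin-comm f = begin
  sumFin (λ j → sumFin (f j))             ≡⟨ sumFin≡sum (λ j → sumFin (f j)) ⟩
  sum (λ j → sumFin (f j))                ≡⟨ sum-cong-≗ (λ j → sumFin≡sum (f j)) ⟩
  sum (λ j → sum (f j))                   ≡⟨ ∑-comm f ⟩
  sum (λ i → sum (λ j → f j i))           ≡⟨ sum-cong-≗ (λ i → sumFin≡sum (λ j → f j i)) ⟨
  sum (λ i → sumFin (λ j → f j i))        ≡⟨ sumFin≡sum (λ i → sumFin (λ j → f j i)) ⟨
  sumFin (λ i → sumFin (λ j → f j i))     ∎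
  where open ≡-Reasoning

module _ {n m : ℕ} where

  pairInd-zero-or-just : ∀ (N : JobAssignment n m) j i → pairInd N j i ≡ 0 ⊎ N j ≡ just i
  pairInd-zero-or-just N j i with N j
  ... | nothing = inj₁ refl
  ... | just i′ with i′ ≟ i
  ...   | yes refl = inj₂ refl
  ...   | no _     = inj₁ refl

  pairInd-≢ : ∀ {N : JobAssignment n m} {j i} → N j ≢ just i → pairInd N j i ≡ 0
  pairInd-≢ {N} {j} {i} Nj≢i with pairInd-zero-or-just N j i
  ... | inj₁ ≡0   = ≡0
  ... | inj₂ Nj≡i = contradiction Nj≡i Nj≢i

  pairInd-just : ∀ {N : JobAssignment n m} {j i} → N j ≡ just i → pairInd N j i ≡ 1
  pairInd-just {N} {j} {i} Nj≡i rewrite Nj≡i with i ≟ i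
  ... | yes _  = refl
  ... | no i≢i = contradiction refl i≢i

  pairInd-nothing : ∀ {N : JobAssignment n m} {j i} → N j ≡ nothing → pairInd N j i ≡ 0
  pairInd-nothing Nj≡nothing rewrite Nj≡nothing = refl

  matchedInd-nothing : ∀ {N : JobAssignment n m} {j} → N j ≡ nothing → matchedInd N j ≡ 0
  matchedInd-nothing Nj≡nothing rewrite Nj≡nothing = refl

  matchedInd-just : ∀ {N : JobAssignment n m} {j i} → N j ≡ just i → matchedInd N j ≡ 1
  matchedInd-just Nj≡i rewrite Nj≡i = refl

  sumFin-pairInd : ∀ (N : JobAssignment n m) j → sumFin (pairInd N j) ≡ matchedInd N j
  sumFin-pairInd N j = byCases (N j) refl
    where
    byCases : ∀ x → N j ≡ x → sumFin (pairInd N j) ≡ matchedInd N j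
    byCases nothing Nj≡nothing = begin
      sumFin (pairInd N j)  ≡⟨ sumFin-vanishing (λ i → pairInd-nothing {N} {j} {i} Nj≡nothing) ⟩
      0                     ≡⟨ matchedInd-nothing {N} Nj≡nothing ⟨
      matchedInd N j        ∎
      where open ≡-Reasoning
    byCases (just i) Nj≡i = begin
      sumFin (pairInd N j)  ≡⟨ sumFin-single i (λ k k≢i → pairInd-≢ {N} {j} {k} (k≢i ∘ just-injective ∘ sameImage)) ⟩
      pairInd N j i         ≡⟨ pairInd-just {N} Nj≡i ⟩
      1                     ≡⟨ matchedInd-just {N} Nj≡i ⟨
      matchedInd N j        ∎
      where
      open ≡-Reasoning
      sameImage : ∀ {k} → N j ≡ just k → just k ≡ just i
      sameImage Nj≡k = trans (sym Nj≡k) Nj≡i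

  card≡sumFin-degree : ∀ (N : JobAssignment n m) → card N ≡ sumFin (degree N)
  card≡sumFin-degree N = begin
    sumFin (matchedInd N)                          ≡⟨ sumFin≡sum (matchedInd N) ⟩
    sum (matchedInd N)                             ≡⟨ sum-cong-≗ (sumFin-pairInd N) ⟨
    sum (λ j → sumFin (pairInd N j))               ≡⟨ sumFin≡sum (λ j → sumFin (pairInd N j)) ⟨
    sumFin (λ j → sumFin (pairInd N j))            ≡⟨ sumFin-comm (pairInd N) ⟩
    sumFin (degree N)                              ∎
    where open ≡-Reasoning

  matchedInd≤1 : ∀ (N : JobAssignment n m) j → matchedInd N j ≤ 1
  matchedInd≤1 N j with N j
  ... | nothing = z≤n
  ... | just _  = ≤-refl

  pairInd-mono : ∀ (N N′ : JobAssignment n m) j i →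
                 (N j ≡ just i → N′ j ≡ just i) → pairInd N j i ≤ pairInd N′ j i
  pairInd-mono N N′ j i N⇒N′ with pairInd-zero-or-just N j i
  ... | inj₁ ≡0   = ≤-trans (≤-reflexive ≡0) z≤n
  ... | inj₂ Nj≡i = ≤-reflexive (trans (pairInd-just {N} Nj≡i) (sym (pairInd-just {N′} (N⇒N′ Nj≡i))))

  _∖dom_ : JobAssignment n m → JobAssignment n m → JobAssignment n m
  (N ∖dom M) j with M j
  ... | nothing = N j
  ... | just _  = nothing

  ∖dom-just : ∀ {N M : JobAssignment n m} {j i} →
              (N ∖dom M) j ≡ just i → M j ≡ nothing × N j ≡ just i
  ∖dom-just {N} {M} {j} with M j
  ... | nothing = λ Nj≡i → refl , Nj≡i
  ... | just _  = λ ()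

  matchedInd≤matchedInd-+-∖dom : ∀ (N M : JobAssignment n m) j →
                                 matchedInd N j ≤ matchedInd M j + matchedInd (N ∖dom M) j
  matchedInd≤matchedInd-+-∖dom N M j with M j
  ... | nothing = ≤-refl
  ... | just _  = matchedInd≤1 N j

  card≤card-+-∖dom : ∀ (N M : JobAssignment n m) → card N ≤ card M + card (N ∖dom M)
  card≤card-+-∖dom N M = ≤-trans (sumFin-mono (matchedInd≤matchedInd-+-∖dom N M))
                                 (≤-reflexive (sumFin-+ (matchedInd M) (matchedInd (N ∖dom M))))

  degree-∖dom≤degreeˡ : ∀ (N M : JobAssignment n m) i → degree (N ∖dom M) i ≤ degree N i
  degree-∖dom≤degreeˡ N M i =
    sumFin-mono (λ j → pairInd-mono (N ∖dom M) N j i (λ eq → proj₂ (∖dom-just {N} {M} eq)))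

  -- The half of strong maximality the bound needs: M itself need not be a PD-matching.
  NonExtendable : (Fin n → Fin m → ℕ) → JobAssignment n m → Set
  NonExtendable b M = ∀ j i → M j ≡ nothing → b j i ≤ degree M i

  module _ {b : Fin n → Fin m → ℕ} {N M : JobAssignment n m}
           (N-pd : IsPDMatching b N) (M-nonExtendable : NonExtendable b M) where

    degree-∖dom≤degreeʳ : ∀ i → degree (N ∖dom M) i ≤ degree M i
    degree-∖dom≤degreeʳ i with degree N i ≤? degree M i
    ... | yes dN≤dM = ≤-trans (degree-∖dom≤degreeˡ N M i) dN≤dM
    ... | no dN≰dM  = ≤-trans (≤-reflexive (sumFin-vanishing noPairAt-i)) z≤n
      where
      noPairAt-i : ∀ j → pairInd (N ∖dom M) j i ≡ 0
      noPairAt-i j = pairInd-≢ {N ∖dom M} {j} {i} λ pair →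
        let (Mj≡nothing , Nj≡i) = ∖dom-just {N} {M} pair
        in dN≰dM (≤-trans (N-pd j i Nj≡i) (M-nonExtendable j i Mj≡nothing))

    card≤2*card : card N ≤ 2 * card M
    card≤2*card = begin
      card N                             ≤⟨ card≤card-+-∖dom N M ⟩
      card M + card (N ∖dom M)           ≡⟨ cong (card M +_) (card≡sumFin-degree (N ∖dom M)) ⟩
      card M + sumFin (degree (N ∖dom M))
        ≤⟨ +-monoʳ-≤ (card M) (sumFin-mono degree-∖dom≤degreeʳ) ⟩
      card M + sumFin (degree M)         ≡⟨ cong (card M +_) (card≡sumFin-degree M) ⟨
      card M + card M                    ≡⟨ cong (card M +_) (+-identityʳ (card M)) ⟨
      2 * card M                         ∎
      where open ≤-Reasoning

claim1 : (n m : ℕ) (b : Fin n → Fin m → ℕ) (M M* : JobAssignment n m) →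
         IsStronglyMaximal b M → IsMaximumPDMatching b M* →
         card M* ≤ 2 * card M
claim1 n m b M M* (_ , M-nonExtendable) (M*-pd , _) =
  card≤2*card M*-pd M-nonExtendable
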